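{- For every instance of MLCM-P\_PATH there exists an optimal layout with the following property: whenever two lines $l=[i,j]$ and $l'=[i',j']$ with $i<i'$ cross, the crossing occurs on edge $(i',i'+1)$.
   Context: Stations $1,\dots,n$ lie on a horizontal line, joined by edges $(i,i+1)$. A line is $[i,j]$ with $1\le i<j\le n$, travelling along edges $(i,i+1),\dots,(j-1,j)$; $\mathcal L$ is a finite set of pairwise distinct lines; $\mathcal L_{i,i+1}$ is the set of lines traversing edge $(i,i+1)$; $[a,b]$ passes through station $i$ if $a<i<b$. A layout specifies, for every edge, a top-to-bottom order of its lines at each of its two ends; two lines cross on an edge if their orders differ at the two ends; the crossing number counts (pair, edge) crossings. Admissible: lines passing through station $i$ keep the same relative order at the station-$i$ ends of edges $(i-1,i)$ and $(i,i+1)$. Periphery condition: each line $[a,b]$ is above all or below all lines passing through $a$ at the station-$a$ end of $(a,a+1)$, and above all or below all lines passing through $b$ at the station-$b$ end of $(b-1,b)$. An optimal layout for MLCM-P\_PATH is an admissible layout satisfying the periphery condition with minimum crossing number. -}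

module Defs where

open import Data.Nat using (ℕ; zero; suc; _+_; _∸_; _≤_; _<_; _≤?_; _<?_)
open import Data.Nat.Properties using () renaming (_≟_ to _≟ℕ_)
open import Data.Product using (Σ; ∃; _×_; _,_; proj₁; proj₂)
open import Data.Product.Properties using (≡-dec)
open import Data.Sum using (_⊎_)
open import Data.List using (List; []; _∷_; _++_; map; filter; upTo; length)
open import Data.Nat.ListAction using (sum)
open import Data.List.Membership.Propositional using (_∈_)
open import Data.List.Relation.Unary.Unique.Propositional using (Unique)
open import Data.List.Relation.Binary.Permutation.Propositional using (_↭_)
open import Relation.Binary.PropositionalEquality using (_≡_)
open import Relation.Nullary using (Dec; yes; no; ¬_)
open import Relation.Nullary.Decidable using (_×-dec_)
open import Relation.Binary using (DecidableEquality)

-- Stations are natural numbers 1..n; a line [a,b] is the pair (a , b).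
Line : Set
Line = ℕ × ℕ

_≟L_ : DecidableEquality Line
_≟L_ = ≡-dec _≟ℕ_ _≟ℕ_

ValidLine : ℕ → Line → Set
ValidLine n (a , b) = (1 ≤ a) × (a < b) × (b ≤ n)

Instance : ℕ → List Line → Set
Instance n L = (∀ l → l ∈ L → ValidLine n l) × Unique L

Traverses : ℕ → Line → Set
Traverses k (a , b) = (a ≤ k) × (k < b)

traverses? : (k : ℕ) → (l : Line) → Dec (Traverses k l)
traverses? k (a , b) = (a ≤? k) ×-dec (k <? b)

linesOn : List Line → ℕ → List Line
linesOn L k = filter (traverses? k) L

PassesThrough : ℕ → Line → Set
PassesThrough i (a , b) = (a < i) × (i < b)

-- x is strictly above y in the top-to-bottom order xs
Above : List Line → Line → Line → Set
Above xs x y = Σ (List Line) λ ys → Σ (List Line) λ zs → (xs ≡ ys ++ (x ∷ zs)) × (y ∈ zs)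

-- A layout: for every edge (k,k+1), the top-to-bottom orders at its
-- left end (station k) and at its right end (station k+1).
record Layout : Set where
  constructor layout
  field
    leftEnd  : ℕ → List Line
    rightEnd : ℕ → List Line
open Layout public

WellFormed : ℕ → List Line → Layout → Set
WellFormed n L λ′ = ∀ k → 1 ≤ k → k < n →
  (leftEnd λ′ k ↭ linesOn L k) × (rightEnd λ′ k ↭ linesOn L k)

CrossOn : Layout → ℕ → Line → Line → Set
CrossOn λ′ k l l′ =
  (Above (leftEnd λ′ k) l l′ × Above (rightEnd λ′ k) l′ l)
  ⊎ (Above (leftEnd λ′ k) l′ l × Above (rightEnd λ′ k) l l′)

indexOf : Line → List Line → ℕ
indexOf x [] = 0
indexOf x (y ∷ ys) with x ≟L y
... | yes _ = 0
... | no  _ = suc (indexOf x ys)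

orderedPairs : List Line → List (Line × Line)
orderedPairs [] = []
orderedPairs (x ∷ xs) = map (x ,_) xs ++ orderedPairs xs

crossingsOn : Layout → ℕ → ℕ
crossingsOn λ′ k =
  length (filter (λ p → indexOf (proj₂ p) (rightEnd λ′ k) <? indexOf (proj₁ p) (rightEnd λ′ k))
                 (orderedPairs (leftEnd λ′ k)))

crossingNumber : ℕ → Layout → ℕ
crossingNumber n λ′ = sum (map (λ k → crossingsOn λ′ (suc k)) (upTo (n ∸ 1)))

Admissible : ℕ → List Line → Layout → Set
Admissible n L λ′ = ∀ i → 1 < i → i < n → ∀ l l′ → l ∈ L → l′ ∈ L →
  PassesThrough i l → PassesThrough i l′ →
  (Above (rightEnd λ′ (i ∸ 1)) l l′ → Above (leftEnd λ′ i) l l′) ×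
  (Above (leftEnd λ′ i) l l′ → Above (rightEnd λ′ (i ∸ 1)) l l′)

Periphery : List Line → Layout → Set
Periphery L λ′ = ∀ a b → (a , b) ∈ L →
  ((∀ l′ → l′ ∈ L → PassesThrough a l′ → Above (leftEnd λ′ a) (a , b) l′)
   ⊎ (∀ l′ → l′ ∈ L → PassesThrough a l′ → Above (leftEnd λ′ a) l′ (a , b)))
  × ((∀ l′ → l′ ∈ L → PassesThrough b l′ → Above (rightEnd λ′ (b ∸ 1)) (a , b) l′)
   ⊎ (∀ l′ → l′ ∈ L → PassesThrough b l′ → Above (rightEnd λ′ (b ∸ 1)) l′ (a , b)))

Feasible : ℕ → List Line → Layout → Set
Feasible n L λ′ = WellFormed n L λ′ × Admissible n L λ′ × Periphery L λ′

Optimal : ℕ → List Line → Layout → Set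
Optimal n L λ′ = Feasible n L λ′ ×
  (∀ μ → Feasible n L μ → crossingNumber n λ′ ≤ crossingNumber n μ)

CrossingsAtLaterStart : List Line → Layout → Set
CrossingsAtLaterStart L λ′ = ∀ i j i′ j′ → (i , j) ∈ L → (i′ , j′) ∈ L → i < i′ →
  ∀ k → CrossOn λ′ k (i , j) (i′ , j′) → k ≡ i′

-- A line leaves its first station above or below all lines passing through it, and likewise
-- enters its last station; call these two choices its sides. For every assignment σ of
-- sides there is a canonical layout: the right end of every edge is sorted by a key built
-- from the end station and end side of a line (ties broken by start station and start
-- side), and at the left end of edge (k, k+1) the lines starting at k are first moved to
-- the top or the bottom as σ prescribes. It is feasible, and two lines cross in it only on
-- the edge where the later of them starts, and only when their sides force it: in every
-- feasible layout realising σ they are then ordered one way just after that start and the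
-- other way just before the first of their ends, so by admissibility they cross in between.
-- Hence the canonical layout of σ has no more crossings than any feasible layout realising
-- σ, and the best of the finitely many canonical layouts is optimal.

module Submission where

open import Defs

open import Level using (0ℓ)
open import Function using (_∘_)
open import Data.Bool using (Bool; true; false; if_then_else_)
open import Data.Nat using (ℕ; zero; suc; _+_; _∸_; _⊔_; _≤_; _<_; _≟_; _<?_; z≤n; s≤s; _≤‴_; ≤‴-refl; ≤‴-step)
open import Data.Nat.Properties
open import Data.Nat.ListAction using (sum)
open import Data.Nat.ListAction.Properties using (sum-++; sum-↭)
open import Algebra.Properties.CommutativeSemigroup +-commutativeSemigroup using () renaming (interchange to +-interchange)
open import Data.Product using (Σ; ∃-syntax; _×_; _,_; proj₁; proj₂)
open import Data.Product.Relation.Binary.Lex.Strict using (×-strictTotalOrder)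
open import Data.Sum using (_⊎_; inj₁; inj₂)
open import Data.List using (List; []; _∷_; _++_; map; filter; upTo; length; cartesianProduct; cartesianProductWith)
open import Data.List.Properties using (map-++; map-∘)
open import Data.List.Membership.Propositional using (_∈_; find)
open import Data.List.Membership.Propositional.Properties
  using (∈-++⁺ʳ; ∈-++⁻; ∈-map⁻; ∈-filter⁻; ∈-filter⁺; ∈-upTo⁺; ∈-upTo⁻; ∈-cartesianProductWith⁺)
open import Data.List.Membership.DecPropositional _≟L_ using (_∈?_)
open import Data.List.Relation.Unary.Any as Any using (here; there)
open import Data.List.Relation.Unary.All as All using (All; _∷_; all?)
open import Data.List.Relation.Unary.All.Properties using (¬All⇒Any¬)
open import Data.List.Relation.Unary.AllPairs using (AllPairs; _∷_)
open import Data.List.Relation.Unary.Unique.Propositional using (Unique)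
open import Data.List.Relation.Unary.Unique.Propositional.Properties using (filter⁺; upTo⁺)
open import Data.List.Relation.Unary.Sorted.TotalOrder.Properties using (Sorted⇒AllPairs)
open import Data.List.Relation.Binary.Permutation.Propositional as ↭ using (_↭_; ↭-sym; ↭⇒↭ₛ)
open import Data.List.Relation.Binary.Permutation.Propositional.Properties using (∈-resp-↭; map⁺)
import Data.List.Relation.Binary.Permutation.Setoid.Properties as ↭ₛ
import Data.List.Sort
open import Data.List.Extrema.Nat using (argmin; f[argmin]≤f[xs])
open import Relation.Binary.Bundles using (StrictTotalOrder; DecTotalOrder)
open import Relation.Binary.Definitions using (tri<; tri≈; tri>)
import Relation.Binary.Construct.On as On
import Relation.Binary.Properties.StrictTotalOrder as StrictTotalOrderProperties
open import Relation.Binary.PropositionalEquality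
open import Relation.Nullary using (Dec; yes; no; does; ¬_; contradiction)
open import Relation.Nullary.Decidable using (map′; _×-dec_; _⊎-dec_; _→-dec_)
open import Relation.Unary using (Pred; Decidable)

Unique-resp-↭ : {xs ys : List Line} → xs ↭ ys → Unique xs → Unique ys
Unique-resp-↭ p = ↭ₛ.Unique-resp-↭ (setoid Line) (↭⇒↭ₛ p)

private variable
  x y z w : Line
  xs : List Line

Above-head : y ∈ xs → Above (x ∷ xs) x y
Above-head y∈xs = [] , _ , refl , y∈xs

Above-tail : Above xs x y → Above (w ∷ xs) x y
Above-tail {w = w} (ys , zs , refl , y∈zs) = w ∷ ys , zs , refl , y∈zs

Above-∷⁻ : Above (w ∷ xs) x y → (w ≡ x × y ∈ xs) ⊎ Above xs x y
Above-∷⁻ ([] , _ , refl , y∈xs) = inj₁ (refl , y∈xs)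
Above-∷⁻ (_ ∷ ys , zs , refl , y∈zs) = inj₂ (ys , zs , refl , y∈zs)

Above? : ∀ xs x y → Dec (Above xs x y)
Above? [] x y = no λ { ([] , _ , () , _) ; (_ ∷ _ , _ , () , _) }
Above? (w ∷ xs) x y = map′ Above-∷⁺ Above-∷⁻ (((w ≟L x) ×-dec (y ∈? xs)) ⊎-dec Above? xs x y)
  where
  Above-∷⁺ : (w ≡ x × y ∈ xs) ⊎ Above xs x y → Above (w ∷ xs) x y
  Above-∷⁺ (inj₁ (refl , y∈xs)) = Above-head y∈xs
  Above-∷⁺ (inj₂ above) = Above-tail above

Above⇒∈ : Above xs x y → x ∈ xs × y ∈ xs
Above⇒∈ (ys , _ , refl , y∈zs) = ∈-++⁺ʳ ys (here refl) , ∈-++⁺ʳ ys (there y∈zs)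

AllPairs-Above : ∀ {r} {R : Line → Line → Set r} → AllPairs R xs → Above xs x y → R x y
AllPairs-Above (x∼zs ∷ _) ([] , _ , refl , y∈zs) = All.lookup x∼zs y∈zs
AllPairs-Above (_ ∷ rs) (_ ∷ ys , zs , refl , y∈zs) = AllPairs-Above rs (ys , zs , refl , y∈zs)

Above⇒≢ : Unique xs → Above xs x y → x ≢ y
Above⇒≢ = AllPairs-Above

Above-total : x ∈ xs → y ∈ xs → x ≢ y → Above xs x y ⊎ Above xs y x
Above-total (here refl) (here refl) x≢y = contradiction refl x≢y
Above-total (here refl) (there y∈xs) _ = inj₁ (Above-head y∈xs)
Above-total (there x∈xs) (here refl) _ = inj₂ (Above-head x∈xs)
Above-total (there x∈xs) (there y∈xs) x≢y with Above-total x∈xs y∈xs x≢y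
... | inj₁ above = inj₁ (Above-tail above)
... | inj₂ below = inj₂ (Above-tail below)

indexOf-head : indexOf x (x ∷ xs) ≡ 0
indexOf-head {x} with x ≟L x
... | yes _ = refl
... | no x≢x = contradiction refl x≢x

indexOf-tail : x ≢ w → indexOf x (w ∷ xs) ≡ suc (indexOf x xs)
indexOf-tail {x} {w} x≢w with x ≟L w
... | yes x≡w = contradiction x≡w x≢w
... | no _ = refl

Above⇒indexOf< : Unique xs → Above xs x y → indexOf x xs < indexOf y xs
Above⇒indexOf< {x = x} {y} (x≢zs ∷ _) ([] , zs , refl , y∈zs)
  rewrite indexOf-head {x} {zs} | indexOf-tail {y} {x} {zs} (≢-sym (All.lookup x≢zs y∈zs)) = s≤s z≤n
Above⇒indexOf< {x = x} {y} (w≢rest ∷ u) (w ∷ ys , zs , refl , y∈zs)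
  rewrite indexOf-tail {x} {w} {ys ++ x ∷ zs} (≢-sym (All.lookup w≢rest (∈-++⁺ʳ ys (here refl))))
        | indexOf-tail {y} {w} {ys ++ x ∷ zs} (≢-sym (All.lookup w≢rest (∈-++⁺ʳ ys (there y∈zs))))
  = s≤s (Above⇒indexOf< u (ys , zs , refl , y∈zs))

Above-asym : Unique xs → Above xs x y → ¬ Above xs y x
Above-asym u x≻y y≻x = <-asym (Above⇒indexOf< u x≻y) (Above⇒indexOf< u y≻x)

indexOf<⇒Above : Unique xs → x ∈ xs → y ∈ xs → indexOf x xs < indexOf y xs → Above xs x y
indexOf<⇒Above u x∈xs y∈xs lt with Above-total x∈xs y∈xs (λ { refl → <-irrefl refl lt })
... | inj₁ above = above
... | inj₂ below = contradiction lt (<-asym (Above⇒indexOf< u below))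

Above-trans : Unique xs → Above xs x y → Above xs y z → Above xs x z
Above-trans u x≻y y≻z = indexOf<⇒Above u (proj₁ (Above⇒∈ x≻y)) (proj₂ (Above⇒∈ y≻z))
  (<-trans (Above⇒indexOf< u x≻y) (Above⇒indexOf< u y≻z))

orderedPairs⇒Above : (x , y) ∈ orderedPairs xs → Above xs x y
orderedPairs⇒Above {xs = w ∷ xs} p∈ with ∈-++⁻ (map (w ,_) xs) p∈
... | inj₁ p∈head with ∈-map⁻ (w ,_) p∈head
...   | _ , y∈xs , refl = Above-head y∈xs
orderedPairs⇒Above {xs = w ∷ xs} p∈ | inj₂ p∈tail = Above-tail (orderedPairs⇒Above p∈tail)

module SortBy {ℓ₁ ℓ₂} (K : StrictTotalOrder 0ℓ ℓ₁ ℓ₂) (key : Line → StrictTotalOrder.Carrier K) where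

  open StrictTotalOrder K using (irrefl; asym; module Eq) renaming (_<_ to _<ₖ_; _≈_ to _≈ₖ_)
  private
    byKey = On.decTotalOrder (StrictTotalOrderProperties.decTotalOrder K) key

  open Data.List.Sort byKey public using (sort; sort-↭)
  open Data.List.Sort byKey using (sort-↗)

  ∈-sort⁺ : x ∈ xs → x ∈ sort xs
  ∈-sort⁺ = ∈-resp-↭ (↭-sym (sort-↭ _))

  Above-sort⇒≤ : Above (sort xs) x y → key x <ₖ key y ⊎ key x ≈ₖ key y
  Above-sort⇒≤ = AllPairs-Above (Sorted⇒AllPairs (DecTotalOrder.totalOrder byKey) (sort-↗ _))

  Above-sort⇒< : Unique xs → (∀ {x y} → x ∈ xs → y ∈ xs → key x ≈ₖ key y → x ≡ y) →
                 Above (sort xs) x y → key x <ₖ key y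
  Above-sort⇒< u key-inj above with Above-sort⇒≤ above
  ... | inj₁ lt = lt
  ... | inj₂ eq = contradiction (key-inj (∈-resp-↭ (sort-↭ _) x∈) (∈-resp-↭ (sort-↭ _) y∈) eq)
                                (Above⇒≢ (Unique-resp-↭ (↭-sym (sort-↭ _)) u) above)
    where x∈ = proj₁ (Above⇒∈ above) ; y∈ = proj₂ (Above⇒∈ above)

  <⇒Above-sort : x ∈ xs → y ∈ xs → key x <ₖ key y → Above (sort xs) x y
  <⇒Above-sort x∈ y∈ lt with Above-total (∈-sort⁺ x∈) (∈-sort⁺ y∈) (λ { refl → irrefl Eq.refl lt })
  ... | inj₁ above = above
  ... | inj₂ below with Above-sort⇒≤ below
  ...   | inj₁ gt = contradiction gt (asym lt)
  ...   | inj₂ eq = contradiction lt (irrefl (Eq.sym eq))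

indicator : ∀ {p} {P : Set p} → Dec P → ℕ
indicator (yes _) = 1
indicator (no _) = 0

module _ {p q} {P : Set p} {Q : Set q} where

  indicator-cong : (P → Q) → (Q → P) → (P? : Dec P) (Q? : Dec Q) → indicator P? ≡ indicator Q?
  indicator-cong _ _ (yes _) (yes _) = refl
  indicator-cong P⇒Q _ (yes p) (no ¬q) = contradiction (P⇒Q p) ¬q
  indicator-cong _ Q⇒P (no ¬p) (yes q) = contradiction (Q⇒P q) ¬p
  indicator-cong _ _ (no _) (no _) = refl

module _ {p} {P : Set p} where

  indicator≤1 : (P? : Dec P) → indicator P? ≤ 1
  indicator≤1 (yes _) = s≤s z≤n
  indicator≤1 (no _) = z≤n

  indicator-yes : (P? : Dec P) → P → indicator P? ≡ 1
  indicator-yes (yes _) _ = refl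
  indicator-yes (no ¬p) p = contradiction p ¬p

  indicator-positive : (P? : Dec P) → 1 ≤ indicator P? → P
  indicator-positive (yes p) _ = p

module _ {a} {A : Set a} where

  length-filter≡sum : ∀ {p} {P : Pred A p} (P? : Decidable P) xs →
                      length (filter P? xs) ≡ sum (map (λ x → indicator (P? x)) xs)
  length-filter≡sum P? [] = refl
  length-filter≡sum P? (x ∷ xs) with P? x
  ... | yes _ = cong suc (length-filter≡sum P? xs)
  ... | no _ = length-filter≡sum P? xs

  sum-map-++ : (f : A → ℕ) → ∀ xs ys → sum (map f (xs ++ ys)) ≡ sum (map f xs) + sum (map f ys)
  sum-map-++ f xs ys = trans (cong sum (map-++ f xs ys)) (sum-++ (map f xs) (map f ys))

  sum-map-↭ : (f : A → ℕ) → ∀ {xs ys} → xs ↭ ys → sum (map f xs) ≡ sum (map f ys)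
  sum-map-↭ f p = sum-↭ (map⁺ f p)

  sum-map-cong : ∀ {f g : A → ℕ} xs → (∀ {x} → x ∈ xs → f x ≡ g x) → sum (map f xs) ≡ sum (map g xs)
  sum-map-cong [] _ = refl
  sum-map-cong (x ∷ xs) f≗g = cong₂ _+_ (f≗g (here refl)) (sum-map-cong xs (f≗g ∘ there))

  sum-map-mono : ∀ {f g : A → ℕ} xs → (∀ {x} → x ∈ xs → f x ≤ g x) → sum (map f xs) ≤ sum (map g xs)
  sum-map-mono [] _ = z≤n
  sum-map-mono (x ∷ xs) f≤g = +-mono-≤ (f≤g (here refl)) (sum-map-mono xs (f≤g ∘ there))

  sum-map-zero : ∀ {f : A → ℕ} xs → (∀ {x} → x ∈ xs → f x ≡ 0) → sum (map f xs) ≡ 0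
  sum-map-zero xs f≡0 = trans (sum-map-cong xs f≡0) (sum-map-const xs)
    where
    sum-map-const : ∀ xs → sum (map (λ _ → 0) xs) ≡ 0
    sum-map-const [] = refl
    sum-map-const (_ ∷ xs) = sum-map-const xs

  sum-map-+ : (f g : A → ℕ) → ∀ xs → sum (map (λ x → f x + g x) xs) ≡ sum (map f xs) + sum (map g xs)
  sum-map-+ f g [] = refl
  sum-map-+ f g (x ∷ xs) = trans (cong (f x + g x +_) (sum-map-+ f g xs))
                                 (+-interchange (f x) (g x) (sum (map f xs)) (sum (map g xs)))

  ≤-sum-map : (f : A → ℕ) → ∀ {x xs} → x ∈ xs → f x ≤ sum (map f xs)
  ≤-sum-map f (here refl) = m≤m+n _ _
  ≤-sum-map f {xs = y ∷ _} (there x∈xs) = ≤-trans (≤-sum-map f x∈xs) (m≤n+m _ (f y))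

  sum-map-positive : (f : A → ℕ) → ∀ xs → 1 ≤ sum (map f xs) → ∃[ x ] x ∈ xs × 1 ≤ f x
  sum-map-positive f (x ∷ xs) pos with f x in eq
  ... | suc _ = x , here refl , subst (1 ≤_) (sym eq) (s≤s z≤n)
  ... | zero with sum-map-positive f xs pos
  ...   | y , y∈xs , fy-pos = y , there y∈xs , fy-pos

  sum-map-≤1 : ∀ {f : A → ℕ} {xs} → Unique xs → (∀ x → f x ≤ 1) →
               (∀ {x y} → 1 ≤ f x → 1 ≤ f y → x ≡ y) → sum (map f xs) ≤ 1
  sum-map-≤1 {xs = []} _ _ _ = z≤n
  sum-map-≤1 {f} {x ∷ xs} (x∉xs ∷ u) f≤1 single with f x ≟ 0
  ... | yes fx≡0 = subst (λ v → v + sum (map f xs) ≤ 1) (sym fx≡0) (sum-map-≤1 u f≤1 single)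
  ... | no fx≢0 = begin
    f x + sum (map f xs) ≡⟨ cong (f x +_) rest≡0 ⟩
    f x + 0              ≡⟨ +-identityʳ (f x) ⟩
    f x                  ≤⟨ f≤1 x ⟩
    1                    ∎
    where
    open ≤-Reasoning
    rest≡0 : sum (map f xs) ≡ 0
    rest≡0 = sum-map-zero xs λ {y} y∈xs → n≤0⇒n≡0 (≮⇒≥ λ fy-pos →
             All.lookup x∉xs y∈xs (single (n≢0⇒n>0 fx≢0) fy-pos))

sum-map-swap : ∀ {a b} {A : Set a} {B : Set b} (F : A → B → ℕ) xs ys →
  sum (map (λ x → sum (map (F x) ys)) xs) ≡ sum (map (λ y → sum (map (λ x → F x y) xs)) ys)
sum-map-swap F [] ys = sym (sum-map-zero ys (λ _ → refl))
sum-map-swap F (x ∷ xs) ys = trans (cong (sum (map (F x) ys) +_) (sum-map-swap F xs ys))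
                                   (sym (sum-map-+ (F x) (λ y → sum (map (λ x → F x y) xs)) ys))

≤-by-positivity : ∀ {m n} → m ≤ 1 → (1 ≤ m → 1 ≤ n) → m ≤ n
≤-by-positivity z≤n _ = z≤n
≤-by-positivity (s≤s z≤n) positive = positive (s≤s z≤n)

module SumPairs (h : Line × Line → ℕ) where

  sumPairs : List Line → ℕ
  sumPairs xs = sum (map h (orderedPairs xs))

  sumRow : Line → List Line → ℕ
  sumRow x xs = sum (map (λ y → h (x , y)) xs)

  sumPairs-∷ : ∀ x xs → sumPairs (x ∷ xs) ≡ sumRow x xs + sumPairs xs
  sumPairs-∷ x xs = trans (sum-map-++ h (map (x ,_) xs) (orderedPairs xs))
                          (cong (λ ys → sum ys + sumPairs xs) (sym (map-∘ xs)))

  module _ (h-sym : ∀ x y → h (x , y) ≡ h (y , x)) where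

    sumPairs-↭ : ∀ {xs ys} → xs ↭ ys → sumPairs xs ≡ sumPairs ys
    sumPairs-↭ ↭.refl = refl
    sumPairs-↭ {x ∷ xs} {x ∷ ys} (↭.prep x p) = begin
      sumPairs (x ∷ xs)        ≡⟨ sumPairs-∷ x xs ⟩
      sumRow x xs + sumPairs xs ≡⟨ cong₂ _+_ (sum-map-↭ _ p) (sumPairs-↭ p) ⟩
      sumRow x ys + sumPairs ys ≡⟨ sumPairs-∷ x ys ⟨
      sumPairs (x ∷ ys)        ∎
      where open ≡-Reasoning
    sumPairs-↭ {x ∷ y ∷ xs} {y ∷ x ∷ ys} (↭.swap x y p) = begin
      sumPairs (x ∷ y ∷ xs)
        ≡⟨ trans (sumPairs-∷ x (y ∷ xs)) (cong₂ _+_ refl (sumPairs-∷ y xs)) ⟩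
      (h (x , y) + sumRow x xs) + (sumRow y xs + sumPairs xs)
        ≡⟨ cong₂ (λ a b → (h (x , y) + a) + b) (sum-map-↭ _ p) (cong₂ _+_ (sum-map-↭ _ p) (sumPairs-↭ p)) ⟩
      (h (x , y) + sumRow x ys) + (sumRow y ys + sumPairs ys)
        ≡⟨ cong (λ a → (a + sumRow x ys) + (sumRow y ys + sumPairs ys)) (h-sym x y) ⟩
      (h (y , x) + sumRow x ys) + (sumRow y ys + sumPairs ys)
        ≡⟨ +-interchange (h (y , x)) (sumRow x ys) (sumRow y ys) (sumPairs ys) ⟩
      (h (y , x) + sumRow y ys) + (sumRow x ys + sumPairs ys)
        ≡⟨ trans (sumPairs-∷ y (x ∷ ys)) (cong₂ _+_ refl (sumPairs-∷ x ys)) ⟨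
      sumPairs (y ∷ x ∷ ys)
        ∎
      where open ≡-Reasoning
    sumPairs-↭ (↭.trans p q) = trans (sumPairs-↭ p) (sumPairs-↭ q)

  module _ {p} {P : Pred Line p} (P? : Decidable P)
           (h-vanishesˡ : ∀ {x y} → ¬ P x → h (x , y) ≡ 0)
           (h-vanishesʳ : ∀ {x y} → ¬ P y → h (x , y) ≡ 0) where

    sumRow-filter : ∀ x xs → sumRow x (filter P? xs) ≡ sumRow x xs
    sumRow-filter x [] = refl
    sumRow-filter x (y ∷ xs) with P? y
    ... | yes _ = cong (h (x , y) +_) (sumRow-filter x xs)
    ... | no ¬py = trans (sumRow-filter x xs) (cong (_+ sumRow x xs) (sym (h-vanishesʳ ¬py)))

    sumPairs-filter : ∀ xs → sumPairs (filter P? xs) ≡ sumPairs xs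
    sumPairs-filter [] = refl
    sumPairs-filter (x ∷ xs) with P? x
    ... | yes _ = begin
      sumPairs (x ∷ filter P? xs)            ≡⟨ sumPairs-∷ x (filter P? xs) ⟩
      sumRow x (filter P? xs) + sumPairs (filter P? xs) ≡⟨ cong₂ _+_ (sumRow-filter x xs) (sumPairs-filter xs) ⟩
      sumRow x xs + sumPairs xs               ≡⟨ sumPairs-∷ x xs ⟨
      sumPairs (x ∷ xs)                       ∎
      where open ≡-Reasoning
    ... | no ¬px = begin
      sumPairs (filter P? xs)  ≡⟨ sumPairs-filter xs ⟩
      sumPairs xs              ≡⟨ cong (_+ sumPairs xs) (sum-map-zero xs λ _ → h-vanishesˡ ¬px) ⟨
      sumRow x xs + sumPairs xs ≡⟨ sumPairs-∷ x xs ⟨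
      sumPairs (x ∷ xs)        ∎
      where open ≡-Reasoning

private variable
  λ′ μ : Layout
  n k : ℕ
  L : List Line

passes⇒traverses : ∀ {i} → PassesThrough i x → Traverses i x
passes⇒traverses (a<i , i<b) = <⇒≤ a<i , i<b

passes⇒traverses-pred : ∀ {i} → PassesThrough i x → Traverses (i ∸ 1) x
passes⇒traverses-pred {i = i} (a<i , i<b) = ∸-monoˡ-≤ 1 a<i , ≤-<-trans (m∸n≤m i 1) i<b

traverses-first : ∀ {a b} → a < b → Traverses a (a , b)
traverses-first a<b = ≤-refl , a<b

traverses-last : ∀ {a b} → a < b → Traverses (b ∸ 1) (a , b)
traverses-last a<b = ∸-monoˡ-≤ 1 a<b , ∸-monoʳ-< {o = 0} (s≤s z≤n) (≤-trans (s≤s z≤n) a<b)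

traverses⇒edge : Instance n L → x ∈ L → Traverses k x → 1 ≤ k × k < n
traverses⇒edge {x = i , j} inst x∈L (i≤k , k<j) =
  let 1≤i , _ , j≤n = proj₁ inst _ x∈L in ≤-trans 1≤i i≤k , <-≤-trans k<j j≤n

CrossOn? : ∀ λ′ k x y → Dec (CrossOn λ′ k x y)
CrossOn? λ′ k x y = (Above? (leftEnd λ′ k) x y ×-dec Above? (rightEnd λ′ k) y x)
                 ⊎-dec (Above? (leftEnd λ′ k) y x ×-dec Above? (rightEnd λ′ k) x y)

CrossOn-sym : CrossOn λ′ k x y → CrossOn λ′ k y x
CrossOn-sym (inj₁ swapped) = inj₂ swapped
CrossOn-sym (inj₂ swapped) = inj₁ swapped

CrossOn⇒∈ : CrossOn λ′ k x y → x ∈ leftEnd λ′ k × y ∈ leftEnd λ′ k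
CrossOn⇒∈ (inj₁ (x≻y , _)) = Above⇒∈ x≻y
CrossOn⇒∈ (inj₂ (y≻x , _)) = Data.Product.swap (Above⇒∈ y≻x)

crosses : Layout → ℕ → Line × Line → ℕ
crosses λ′ k (x , y) = indicator (CrossOn? λ′ k x y)

crosses-sym : ∀ λ′ k x y → crosses λ′ k (x , y) ≡ crosses λ′ k (y , x)
crosses-sym λ′ k x y = indicator-cong (CrossOn-sym {λ′ = λ′} {k = k}) (CrossOn-sym {λ′ = λ′} {k = k})
                                      (CrossOn? λ′ k x y) (CrossOn? λ′ k y x)

crossingsOn≡sumPairs : Unique L → leftEnd λ′ k ↭ linesOn L k → rightEnd λ′ k ↭ linesOn L k →
                       crossingsOn λ′ k ≡ sum (map (crosses λ′ k) (orderedPairs L))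
crossingsOn≡sumPairs {L} {λ′} {k} uL left↭ right↭ = begin
  crossingsOn λ′ k
    ≡⟨ length-filter≡sum reversed? (orderedPairs left) ⟩
  sum (map (λ p → indicator (reversed? p)) (orderedPairs left))
    ≡⟨ sum-map-cong (orderedPairs left) reversed≡crosses ⟩
  sumPairs left
    ≡⟨ sumPairs-↭ (crosses-sym λ′ k) left↭ ⟩
  sumPairs (linesOn L k)
    ≡⟨ sumPairs-filter (traverses? k) vanishesˡ vanishesʳ L ⟩
  sumPairs L
    ∎
  where
  open ≡-Reasoning
  open SumPairs (crosses λ′ k)
  left = leftEnd λ′ k
  right = rightEnd λ′ k
  reversed? : (p : Line × Line) → Dec (indexOf (proj₂ p) right < indexOf (proj₁ p) right)
  reversed? p = indexOf (proj₂ p) right <? indexOf (proj₁ p) right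

  uLines : Unique (linesOn L k)
  uLines = filter⁺ (traverses? k) uL

  uLeft : Unique left
  uLeft = Unique-resp-↭ (↭-sym left↭) uLines

  uRight : Unique right
  uRight = Unique-resp-↭ (↭-sym right↭) uLines

  left⇒right : x ∈ left → x ∈ right
  left⇒right = ∈-resp-↭ (↭-sym right↭) ∘ ∈-resp-↭ left↭

  reversed≡crosses : ∀ {p} → p ∈ orderedPairs left → indicator (reversed? p) ≡ crosses λ′ k p
  reversed≡crosses {x , y} p∈ = indicator-cong reversed⇒cross cross⇒reversed _ _
    where
    x≻y = orderedPairs⇒Above p∈
    reversed⇒cross : indexOf y right < indexOf x right → CrossOn λ′ k x y
    reversed⇒cross lt = inj₁ (x≻y , indexOf<⇒Above uRight (left⇒right (proj₂ (Above⇒∈ x≻y)))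
                                                         (left⇒right (proj₁ (Above⇒∈ x≻y))) lt)
    cross⇒reversed : CrossOn λ′ k x y → indexOf y right < indexOf x right
    cross⇒reversed (inj₁ (_ , y≻x)) = Above⇒indexOf< uRight y≻x
    cross⇒reversed (inj₂ (y≻x , _)) = contradiction y≻x (Above-asym uLeft x≻y)

  traversing : x ∈ left → Traverses k x
  traversing x∈ = proj₂ (∈-filter⁻ (traverses? k) {xs = L} (∈-resp-↭ left↭ x∈))

  vanishesˡ : ¬ Traverses k x → crosses λ′ k (x , y) ≡ 0
  vanishesˡ {x} {y} ¬tx with CrossOn? λ′ k x y
  ... | yes c = contradiction (traversing (proj₁ (CrossOn⇒∈ {λ′ = λ′} {k = k} c))) ¬tx
  ... | no _ = refl

  vanishesʳ : ¬ Traverses k y → crosses λ′ k (x , y) ≡ 0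
  vanishesʳ {y} {x} ¬ty with CrossOn? λ′ k x y
  ... | yes c = contradiction (traversing (proj₂ (CrossOn⇒∈ {λ′ = λ′} {k = k} c))) ¬ty
  ... | no _ = refl

<∸1⇒suc< : ∀ {b} n → b < n ∸ 1 → suc b < n
<∸1⇒suc< (suc n) b<n = s≤s b<n

suc<⇒<∸1 : ∀ {b} n → suc b < n → b < n ∸ 1
suc<⇒<∸1 (suc n) (s≤s b<n) = b<n

crossingsOfPair : ℕ → Layout → Line × Line → ℕ
crossingsOfPair n λ′ p = sum (map (λ b → crosses λ′ (suc b) p) (upTo (n ∸ 1)))

crossingNumber≡sumPairs : Unique L → WellFormed n L λ′ →
                          crossingNumber n λ′ ≡ sum (map (crossingsOfPair n λ′) (orderedPairs L))
crossingNumber≡sumPairs {L} {n} {λ′} uL wf = trans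
  (sum-map-cong (upTo (n ∸ 1)) λ {b} b∈ →
    let left↭ , right↭ = wf (suc b) (s≤s z≤n) (<∸1⇒suc< n (∈-upTo⁻ b∈)) in
    crossingsOn≡sumPairs {λ′ = λ′} uL left↭ right↭)
  (sum-map-swap (λ b → crosses λ′ (suc b)) (upTo (n ∸ 1)) (orderedPairs L))

module _ {n L μ} (inst : Instance n L) (wf : WellFormed n L μ) where

  Unique-rightEnd : 1 ≤ k → k < n → Unique (rightEnd μ k)
  Unique-rightEnd {k} 1≤k k<n = Unique-resp-↭ (↭-sym (proj₂ (wf k 1≤k k<n))) (filter⁺ (traverses? k) (proj₂ inst))

  Unique-leftEnd : 1 ≤ k → k < n → Unique (leftEnd μ k)
  Unique-leftEnd {k} 1≤k k<n = Unique-resp-↭ (↭-sym (proj₁ (wf k 1≤k k<n))) (filter⁺ (traverses? k) (proj₂ inst))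

  ∈-rightEnd : x ∈ L → Traverses k x → x ∈ rightEnd μ k
  ∈-rightEnd {k = k} x∈L tx = let 1≤k , k<n = traverses⇒edge inst x∈L tx in
    ∈-resp-↭ (↭-sym (proj₂ (wf k 1≤k k<n))) (∈-filter⁺ (traverses? k) x∈L tx)

  -- Either the two lines already cross on edge k, or admissibility carries
  -- their order at the right end of edge k to the left end of edge k + 1.
  order-change⇒crossing : Admissible n L μ →
    ∀ {i j i′ j′ l} → (i , j) ∈ L → (i′ , j′) ∈ L → (i , j) ≢ (i′ , j′) →
    i ≤ k → i′ ≤ k → k ≤ l → l < j → l < j′ →
    Above (leftEnd μ k) (i , j) (i′ , j′) → Above (rightEnd μ l) (i′ , j′) (i , j) →
    ∃[ k′ ] k ≤ k′ × k′ ≤ l × CrossOn μ k′ (i , j) (i′ , j′)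
  order-change⇒crossing adm {i} {j} {i′} {j′} {l} x∈L y∈L x≢y i≤k i′≤k k≤l l<j l<j′ =
    go (≤⇒≤‴ k≤l) i≤k i′≤k
    where
    before-end : ∀ {k} → k ≤‴ l → k < j × k < j′
    before-end k≤‴l = ≤-<-trans (≤‴⇒≤ k≤‴l) l<j , ≤-<-trans (≤‴⇒≤ k≤‴l) l<j′

    go : ∀ {k} → k ≤‴ l → i ≤ k → i′ ≤ k →
         Above (leftEnd μ k) (i , j) (i′ , j′) → Above (rightEnd μ l) (i′ , j′) (i , j) →
         ∃[ k′ ] k ≤ k′ × k′ ≤ l × CrossOn μ k′ (i , j) (i′ , j′)
    go {k} k≤‴l i≤k i′≤k left-x≻y right-y≻x
      with Above-total (∈-rightEnd x∈L (i≤k , proj₁ (before-end k≤‴l)))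
                       (∈-rightEnd y∈L (i′≤k , proj₂ (before-end k≤‴l))) x≢y
    ... | inj₂ y≻x = k , ≤-refl , ≤‴⇒≤ k≤‴l , inj₁ (left-x≻y , y≻x)
    go ≤‴-refl i≤k _ _ right-y≻x | inj₁ right-x≻y =
      let 1≤l , l<n = traverses⇒edge inst x∈L (i≤k , l<j) in
      contradiction right-y≻x (Above-asym (Unique-rightEnd 1≤l l<n) right-x≻y)
    go {k} (≤‴-step 1+k≤‴l) i≤k i′≤k _ right-y≻x | inj₁ right-x≻y
      with 1+k<j , 1+k<j′ ← before-end 1+k≤‴l
      with 1≤k , _ ← traverses⇒edge inst x∈L (i≤k , <-trans (n<1+n k) 1+k<j)
      with _ , 1+k<n ← traverses⇒edge inst x∈L (m≤n⇒m≤1+n i≤k , 1+k<j)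
      with go 1+k≤‴l (m≤n⇒m≤1+n i≤k) (m≤n⇒m≤1+n i′≤k)
              (proj₁ (adm (suc k) (s≤s 1≤k) 1+k<n _ _ x∈L y∈L (s≤s i≤k , 1+k<j) (s≤s i′≤k , 1+k<j′))
                     right-x≻y)
              right-y≻x
    ... | k′ , 1+k≤k′ , k′≤l , crossing = k′ , <⇒≤ 1+k≤k′ , k′≤l , crossing

-- σ l = (s , e): l is on top (true) or at the bottom (false) of the lines passing through
-- its first station (s), resp. its last station (e).
Sides : Set
Sides = Line → Bool × Bool

Extreme : List Line → ℕ → List Line → Line → Set
Extreme L i order l = (∀ t → t ∈ L → PassesThrough i t → Above order l t)
                    ⊎ (∀ t → t ∈ L → PassesThrough i t → Above order t l)

-- The bottom side also records a passing line: through it, two lines leaving (or entering)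
-- a station on opposite sides are ordered.
OnSide : List Line → ℕ → List Line → Line → Bool → Set
OnSide L i order l true  = ∀ {t} → t ∈ L → PassesThrough i t → Above order l t
OnSide L i order l false = (∀ {t} → t ∈ L → PassesThrough i t → Above order t l)
                          × ∃[ t ] t ∈ L × PassesThrough i t

Realises : List Line → Layout → Sides → Set
Realises L μ σ = ∀ {a b} → (a , b) ∈ L →
  OnSide L a (leftEnd μ a) (a , b) (proj₁ (σ (a , b))) × OnSide L b (rightEnd μ (b ∸ 1)) (a , b) (proj₂ (σ (a , b)))

passes? : ∀ i l → Dec (PassesThrough i l)
passes? i (a , b) = (a <? i) ×-dec (i <? b)

AllAbove? : ∀ L i order l → Dec (All (λ t → PassesThrough i t → Above order l t) L)
AllAbove? L i order l = all? (λ t → passes? i t →-dec Above? order l t) L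

sideAt : List Line → ℕ → List Line → Line → Bool
sideAt L i order l = does (AllAbove? L i order l)

Extreme⇒OnSide : ∀ {L i order l} → Extreme L i order l → OnSide L i order l (sideAt L i order l)
Extreme⇒OnSide {L} {i} {order} {l} extreme with AllAbove? L i order l | extreme
... | yes all-above | _ = λ t∈L t-passes → All.lookup all-above t∈L t-passes
... | no ¬all-above | inj₁ above = contradiction (All.tabulate λ {t} t∈L → above t t∈L) ¬all-above
... | no ¬all-above | inj₂ below = (λ {t} t∈L → below t t∈L) , witness
  where
  witness : ∃[ t ] t ∈ L × PassesThrough i t
  witness with find (¬All⇒Any¬ (λ t → passes? i t →-dec Above? order l t) L ¬all-above)
  ... | t , t∈L , ¬implication with passes? i t
  ...   | yes t-passes = t , t∈L , t-passes
  ...   | no ¬t-passes = contradiction (λ t-passes → contradiction t-passes ¬t-passes) ¬implication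

sidesOf : List Line → Layout → Sides
sidesOf L μ l@(a , b) = sideAt L a (leftEnd μ a) l , sideAt L b (rightEnd μ (b ∸ 1)) l

sidesOf-realises : Periphery L μ → Realises L μ (sidesOf L μ)
sidesOf-realises periphery {a} {b} ab∈L =
  Extreme⇒OnSide (proj₁ (periphery a b ab∈L)) , Extreme⇒OnSide (proj₂ (periphery a b ab∈L))

Realises-cong : ∀ {σ τ} → (∀ {l} → l ∈ L → σ l ≡ τ l) → Realises L μ τ → Realises L μ σ
Realises-cong {L} {μ} σ≗τ realises {a} {b} ab∈L =
  subst (λ s → OnSide L a (leftEnd μ a) (a , b) (proj₁ s) × OnSide L b (rightEnd μ (b ∸ 1)) (a , b) (proj₂ s))
        (sym (σ≗τ ab∈L)) (realises ab∈L)

sideChoices : List (Bool × Bool)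
sideChoices = cartesianProduct (true ∷ false ∷ []) (true ∷ false ∷ [])

∈-sideChoices : ∀ c → c ∈ sideChoices
∈-sideChoices (true , true) = here refl
∈-sideChoices (true , false) = there (here refl)
∈-sideChoices (false , true) = there (there (here refl))
∈-sideChoices (false , false) = there (there (there (here refl)))

update : Line → Bool × Bool → Sides → Sides
update l c σ t with t ≟L l
... | yes _ = c
... | no _ = σ t

allSides : List Line → List Sides
allSides [] = (λ _ → true , true) ∷ []
allSides (l ∷ ls) = cartesianProductWith (update l) sideChoices (allSides ls)

allSides-complete : ∀ (τ : Sides) ls → ∃[ σ ] σ ∈ allSides ls × (∀ {l} → l ∈ ls → σ l ≡ τ l)
allSides-complete τ [] = _ , here refl , λ ()
allSides-complete τ (l ∷ ls) with allSides-complete τ ls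
... | σ , σ∈ , σ≗τ = update l (τ l) σ , ∈-cartesianProductWith⁺ (update l) (∈-sideChoices (τ l)) σ∈ , agrees
  where
  agrees : ∀ {t} → t ∈ l ∷ ls → update l (τ l) σ t ≡ τ t
  agrees {t} t∈ with t ≟L l
  ... | yes refl = refl
  ... | no t≢l = σ≗τ (Any.tail t≢l t∈)

n<1+n+n∸j : ∀ {n j} → j ≤ n → n < suc (n + n) ∸ j
n<1+n+n∸j {n} {j} j≤n = begin-strict
  n              ≡⟨ m+n∸n≡m n n ⟨
  n + n ∸ n      ≤⟨ ∸-monoʳ-≤ (n + n) j≤n ⟩
  n + n ∸ j      <⟨ n<1+n (n + n ∸ j) ⟩
  suc (n + n ∸ j) ≡⟨ +-∸-assoc 1 (≤-trans j≤n (m≤m+n n n)) ⟨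
  suc (n + n) ∸ j ∎
  where open ≤-Reasoning

≡⊔-of-starts : ∀ {i i′ k} → i ≤ k → i′ ≤ k → k ≡ i ⊎ k ≡ i′ → k ≡ i ⊔ i′
≡⊔-of-starts _ i′≤i (inj₁ refl) = sym (m≥n⇒m⊔n≡m i′≤i)
≡⊔-of-starts i≤i′ _ (inj₂ refl) = sym (m≤n⇒m⊔n≡n i≤i′)

RightKeys : StrictTotalOrder 0ℓ 0ℓ 0ℓ
RightKeys = ×-strictTotalOrder <-strictTotalOrder <-strictTotalOrder

LeftKeys : StrictTotalOrder 0ℓ 0ℓ 0ℓ
LeftKeys = ×-strictTotalOrder <-strictTotalOrder RightKeys

open StrictTotalOrder RightKeys using () renaming (_<_ to _<ʳ_; _≈_ to _≈ʳ_; asym to <ʳ-asym)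
open StrictTotalOrder LeftKeys using () renaming (_<_ to _<ˡ_; _≈_ to _≈ˡ_)

module Canonical {n L} (inst : Instance n L) (σ : Sides) where

  -- The end key lists the
  -- lines ending on top first, in increasing order of their end j, then those ending at the
  -- bottom, in decreasing order (2n + 1 - j > n ≥ j); the start key breaks ties in the same
  -- nested way. startClass k sends lines starting at k to the top (0) or the bottom (2) and
  -- keeps all other lines (1) in the order of the previous edge.
  startsOnTop endsOnTop : Line → Bool
  startsOnTop l = proj₁ (σ l)
  endsOnTop l = proj₂ (σ l)

  endKey : Line → ℕ
  endKey l@(_ , j) = if endsOnTop l then j else suc (n + n) ∸ j

  startKey : Line → ℕ
  startKey l@(i , _) = if startsOnTop l then n ∸ i else n + i

  startClass : ℕ → Line → ℕ
  startClass k l@(i , _) with i ≟ k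
  ... | yes _ = if startsOnTop l then 0 else 2
  ... | no _ = 1

  rightKey : Line → ℕ × ℕ
  rightKey l = endKey l , startKey l

  leftKey : ℕ → Line → ℕ × ℕ × ℕ
  leftKey k l = startClass k l , rightKey l

  valid : x ∈ L → ValidLine n x
  valid = proj₁ inst _

  endKey-injective : ∀ {i j i′ j′} → j ≤ n → j′ ≤ n → endKey (i , j) ≡ endKey (i′ , j′) → j ≡ j′
  endKey-injective {i} {j} {i′} {j′} j≤n j′≤n eq with endsOnTop (i , j) | endsOnTop (i′ , j′)
  ... | true  | true  = eq
  ... | false | false = ∸-cancelˡ-≡ (≤-trans j≤n n≤1+n+n) (≤-trans j′≤n n≤1+n+n) eq
    where n≤1+n+n = ≤-trans (m≤m+n n n) (n≤1+n (n + n))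
  ... | true  | false = contradiction eq (<⇒≢ (≤-<-trans j≤n (n<1+n+n∸j j′≤n)))
  ... | false | true  = contradiction (sym eq) (<⇒≢ (≤-<-trans j′≤n (n<1+n+n∸j j≤n)))

  startKey-injective : ∀ {i j i′ j′} → 1 ≤ i → 1 ≤ i′ → i ≤ n → i′ ≤ n →
                       startKey (i , j) ≡ startKey (i′ , j′) → i ≡ i′
  startKey-injective {i} {j} {i′} {j′} 1≤i 1≤i′ i≤n i′≤n eq with startsOnTop (i , j) | startsOnTop (i′ , j′)
  ... | true  | true  = ∸-cancelˡ-≡ i≤n i′≤n eq
  ... | false | false = +-cancelˡ-≡ n i i′ eq
  ... | true  | false = contradiction eq (<⇒≢ (<-≤-trans (∸-monoʳ-< 1≤i i≤n) (m≤m+n n i′)))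
  ... | false | true  = contradiction (sym eq) (<⇒≢ (<-≤-trans (∸-monoʳ-< 1≤i′ i′≤n) (m≤m+n n i)))

  rightKey-injective : x ∈ L → y ∈ L → rightKey x ≈ʳ rightKey y → x ≡ y
  rightKey-injective {i , j} {i′ , j′} x∈L y∈L (eq-end , eq-start) =
    let 1≤i , i<j , j≤n = valid x∈L ; 1≤i′ , i′<j′ , j′≤n = valid y∈L in
    cong₂ _,_ (startKey-injective 1≤i 1≤i′ (≤-trans (<⇒≤ i<j) j≤n) (≤-trans (<⇒≤ i′<j′) j′≤n)
                                  eq-start)
              (endKey-injective j≤n j′≤n eq-end)

  leftKey-injective : x ∈ L → y ∈ L → leftKey k x ≈ˡ leftKey k y → x ≡ y
  leftKey-injective x∈L y∈L (_ , eq) = rightKey-injective x∈L y∈L eq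

  <endKey : ∀ {j i′ j′} → j < j′ → j′ ≤ n → j < endKey (i′ , j′)
  <endKey {j} {i′} {j′} j<j′ j′≤n with endsOnTop (i′ , j′)
  ... | true = j<j′
  ... | false = <-trans (<-≤-trans j<j′ j′≤n) (n<1+n+n∸j j′≤n)

  endKey<1+n+n∸ : ∀ {j i′ j′} → j < j′ → j′ ≤ n → endKey (i′ , j′) < suc (n + n) ∸ j
  endKey<1+n+n∸ {j} {i′} {j′} j<j′ j′≤n with endsOnTop (i′ , j′)
  ... | true = ≤-<-trans j′≤n (n<1+n+n∸j (≤-trans (<⇒≤ j<j′) j′≤n))
  ... | false = ∸-monoʳ-< j<j′ (≤-trans j′≤n (≤-trans (m≤m+n n n) (n≤1+n (n + n))))

  endKey-ending : ∀ {a b} → endKey (a , b) ≡ b ⊎ endKey (a , b) ≡ suc (n + n) ∸ b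
  endKey-ending {a} {b} with endsOnTop (a , b)
  ... | true = inj₁ refl
  ... | false = inj₂ refl

  n∸k<startKey : ∀ {k i j} → i < k → k ≤ n → n ∸ k < startKey (i , j)
  n∸k<startKey {k} {i} {j} i<k k≤n with startsOnTop (i , j)
  ... | true = ∸-monoʳ-< i<k k≤n
  ... | false = <-≤-trans (∸-monoʳ-< {o = 0} (≤-<-trans z≤n i<k) k≤n) (m≤m+n n i)

  startKey<n+k : ∀ {k i j} → i < k → startKey (i , j) < n + k
  startKey<n+k {k} {i} {j} i<k with startsOnTop (i , j)
  ... | true = ≤-<-trans (m∸n≤m n i) (m<m+n n (≤-<-trans z≤n i<k))
  ... | false = +-monoʳ-< n i<k

  startClass-passing : PassesThrough k x → startClass k x ≡ 1
  startClass-passing {k} {i , _} (i<k , _) with i ≟ k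
  ... | yes i≡k = contradiction i≡k (<⇒≢ i<k)
  ... | no _ = refl

  startClass-starting : ∀ {a b} → startClass a (a , b) ≡ 0 ⊎ startClass a (a , b) ≡ 2
  startClass-starting {a} {b} with a ≟ a
  ... | no a≢a = contradiction refl a≢a
  ... | yes _ with startsOnTop (a , b)
  ...   | true = inj₁ refl
  ...   | false = inj₂ refl

  startClass<⇒starts : ∀ {i j i′ j′} → startClass k (i , j) < startClass k (i′ , j′) → k ≡ i ⊎ k ≡ i′
  startClass<⇒starts {k} {i} {j} {i′} {j′} lt with i ≟ k | i′ ≟ k
  ... | yes i≡k | _ = inj₁ (sym i≡k)
  ... | no _ | yes i′≡k = inj₂ (sym i′≡k)
  ... | no _ | no _ = contradiction lt (<-irrefl refl)

  startClass<⇒startKey< : ∀ {i j i′ j′} → i ≤ k → i′ ≤ k → 1 ≤ k → k ≤ n →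
    startClass k (i , j) < startClass k (i′ , j′) → startKey (i , j) < startKey (i′ , j′)
  startClass<⇒startKey< {k} {i} {j} {i′} {j′} i≤k i′≤k 1≤k k≤n lt with i ≟ k | i′ ≟ k
  ... | no _ | no _ = contradiction lt (<-irrefl refl)
  startClass<⇒startKey< {k} {i} {j} {i′} {j′} i≤k i′≤k 1≤k k≤n lt | yes refl | yes refl
    with startsOnTop (i , j) | startsOnTop (i , j′) | lt
  ... | true | false | _ = ≤-<-trans (m∸n≤m n i) (m<m+n n 1≤k)
  ... | true | true | ()
  ... | false | true | ()
  ... | false | false | s≤s (s≤s ())
  startClass<⇒startKey< {k} {i} {j} {i′} {j′} i≤k i′≤k 1≤k k≤n lt | yes refl | no i′≢k
    with startsOnTop (i , j) | lt
  ... | true | _ = n∸k<startKey (≤∧≢⇒< i′≤k i′≢k) k≤n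
  ... | false | s≤s ()
  startClass<⇒startKey< {k} {i} {j} {i′} {j′} i≤k i′≤k 1≤k k≤n lt | no i≢k | yes refl
    with startsOnTop (i′ , j′) | lt
  ... | false | _ = startKey<n+k (≤∧≢⇒< i≤k i≢k)
  ... | true | ()

  sameClass⇒<ʳ : startClass k x ≡ startClass k y → leftKey k x <ˡ leftKey k y → rightKey x <ʳ rightKey y
  sameClass⇒<ʳ same (inj₁ lt) = contradiction same (<⇒≢ lt)
  sameClass⇒<ʳ _ (inj₂ (_ , lt)) = lt

  reversedKeys⇒startClass< : leftKey k x <ˡ leftKey k y → rightKey y <ʳ rightKey x → startClass k x < startClass k y
  reversedKeys⇒startClass< (inj₁ lt) _ = lt
  reversedKeys⇒startClass< (inj₂ (_ , x<y)) y<x = contradiction y<x (<ʳ-asym x<y)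

  reversedKeys⇒endKey< : ∀ {i j i′ j′} → i ≤ k → i′ ≤ k → 1 ≤ k → k ≤ n →
    leftKey k (i , j) <ˡ leftKey k (i′ , j′) → rightKey (i′ , j′) <ʳ rightKey (i , j) →
    endKey (i′ , j′) < endKey (i , j)
  reversedKeys⇒endKey< i≤k i′≤k 1≤k k≤n left< right> with right>
  ... | inj₁ endKey> = endKey>
  ... | inj₂ (_ , startKey>) = contradiction startKey>
        (<-asym (startClass<⇒startKey< i≤k i′≤k 1≤k k≤n (reversedKeys⇒startClass< left< right>)))

  module RightSort = SortBy RightKeys rightKey
  module LeftSort k = SortBy LeftKeys (leftKey k)

  canonical : Layout
  canonical = layout (λ k → LeftSort.sort k (linesOn L k)) (λ k → RightSort.sort (linesOn L k))

  private
    uLines : ∀ k → Unique (linesOn L k)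
    uLines k = filter⁺ (traverses? k) (proj₂ inst)

    ∈-lines⁻ : x ∈ linesOn L k → x ∈ L × Traverses k x
    ∈-lines⁻ {k = k} = ∈-filter⁻ (traverses? k) {xs = L}

    ∈-lines⁺ : x ∈ L → Traverses k x → x ∈ linesOn L k
    ∈-lines⁺ {k = k} = ∈-filter⁺ (traverses? k)

  canonical-wellFormed : WellFormed n L canonical
  canonical-wellFormed k _ _ = LeftSort.sort-↭ k (linesOn L k) , RightSort.sort-↭ (linesOn L k)

  Above-leftEnd⇒< : Above (leftEnd canonical k) x y → leftKey k x <ˡ leftKey k y
  Above-leftEnd⇒< {k} = LeftSort.Above-sort⇒< k (uLines k)
    λ x∈ y∈ → leftKey-injective (proj₁ (∈-lines⁻ x∈)) (proj₁ (∈-lines⁻ y∈))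

  Above-rightEnd⇒< : Above (rightEnd canonical k) x y → rightKey x <ʳ rightKey y
  Above-rightEnd⇒< {k} = RightSort.Above-sort⇒< (uLines k)
    λ x∈ y∈ → rightKey-injective (proj₁ (∈-lines⁻ x∈)) (proj₁ (∈-lines⁻ y∈))

  <⇒Above-leftEnd : x ∈ L → y ∈ L → Traverses k x → Traverses k y →
                    leftKey k x <ˡ leftKey k y → Above (leftEnd canonical k) x y
  <⇒Above-leftEnd {k = k} x∈L y∈L tx ty = LeftSort.<⇒Above-sort k (∈-lines⁺ x∈L tx) (∈-lines⁺ y∈L ty)

  <⇒Above-rightEnd : x ∈ L → y ∈ L → Traverses k x → Traverses k y →
                     rightKey x <ʳ rightKey y → Above (rightEnd canonical k) x y
  <⇒Above-rightEnd x∈L y∈L tx ty = RightSort.<⇒Above-sort (∈-lines⁺ x∈L tx) (∈-lines⁺ y∈L ty)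

  canonical-admissible : Admissible n L canonical
  canonical-admissible i _ _ x y x∈L y∈L x-passes y-passes = right⇒left , left⇒right
    where
    sameClass = trans (startClass-passing x-passes) (sym (startClass-passing y-passes))

    right⇒left : Above (rightEnd canonical (i ∸ 1)) x y → Above (leftEnd canonical i) x y
    right⇒left above = <⇒Above-leftEnd x∈L y∈L (passes⇒traverses x-passes) (passes⇒traverses y-passes)
                         (inj₂ (sameClass , Above-rightEnd⇒< above))

    left⇒right : Above (leftEnd canonical i) x y → Above (rightEnd canonical (i ∸ 1)) x y
    left⇒right above = <⇒Above-rightEnd x∈L y∈L (passes⇒traverses-pred x-passes) (passes⇒traverses-pred y-passes)
                         (sameClass⇒<ʳ sameClass (Above-leftEnd⇒< above))

  canonical-periphery : Periphery L canonical
  canonical-periphery a b ab∈L = start-side , end-side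
    where
    a<b : a < b
    a<b = proj₁ (proj₂ (valid ab∈L))

    start-side : Extreme L a (leftEnd canonical a) (a , b)
    start-side with startClass-starting {a} {b}
    ... | inj₁ class≡0 = inj₁ λ t t∈L t-passes →
      <⇒Above-leftEnd ab∈L t∈L (traverses-first a<b) (passes⇒traverses t-passes)
        (inj₁ (subst₂ _<_ (sym class≡0) (sym (startClass-passing t-passes)) (s≤s z≤n)))
    ... | inj₂ class≡2 = inj₂ λ t t∈L t-passes →
      <⇒Above-leftEnd t∈L ab∈L (passes⇒traverses t-passes) (traverses-first a<b)
        (inj₁ (subst₂ _<_ (sym (startClass-passing t-passes)) (sym class≡2) (s≤s (s≤s z≤n))))

    end-side : Extreme L b (rightEnd canonical (b ∸ 1)) (a , b)
    end-side with endKey-ending {a} {b}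
    ... | inj₁ key≡b = inj₁ λ { (a′ , b′) t∈L t-passes@(_ , b<b′) →
      <⇒Above-rightEnd ab∈L t∈L (traverses-last a<b) (passes⇒traverses-pred t-passes)
        (inj₁ (subst (_< endKey (a′ , b′)) (sym key≡b) (<endKey b<b′ (proj₂ (proj₂ (valid t∈L)))))) }
    ... | inj₂ key≡1+n+n∸b = inj₂ λ { (a′ , b′) t∈L t-passes@(_ , b<b′) →
      <⇒Above-rightEnd t∈L ab∈L (passes⇒traverses-pred t-passes) (traverses-last a<b)
        (inj₁ (subst (endKey (a′ , b′) <_) (sym key≡1+n+n∸b)
                     (endKey<1+n+n∸ b<b′ (proj₂ (proj₂ (valid t∈L)))))) }

  canonical-feasible : Feasible n L canonical
  canonical-feasible = canonical-wellFormed , canonical-admissible , canonical-periphery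

  ∈-leftEnd⁻ : x ∈ leftEnd canonical k → x ∈ L × Traverses k x
  ∈-leftEnd⁻ {k = k} = ∈-lines⁻ ∘ ∈-resp-↭ (LeftSort.sort-↭ k (linesOn L k))

  canonical-crossing⇒reversedKeys : CrossOn canonical k x y →
    (leftKey k x <ˡ leftKey k y × rightKey y <ʳ rightKey x) ⊎ (leftKey k y <ˡ leftKey k x × rightKey x <ʳ rightKey y)
  canonical-crossing⇒reversedKeys (inj₁ (left , right)) = inj₁ (Above-leftEnd⇒< left , Above-rightEnd⇒< right)
  canonical-crossing⇒reversedKeys (inj₂ (left , right)) = inj₂ (Above-leftEnd⇒< left , Above-rightEnd⇒< right)

  canonical-crossing⇒starts : ∀ {i j i′ j′} → CrossOn canonical k (i , j) (i′ , j′) → k ≡ i ⊎ k ≡ i′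
  canonical-crossing⇒starts crossing with canonical-crossing⇒reversedKeys crossing
  ... | inj₁ (left< , right>) = startClass<⇒starts (reversedKeys⇒startClass< left< right>)
  ... | inj₂ (left> , right<) = Data.Sum.swap (startClass<⇒starts (reversedKeys⇒startClass< left> right<))

  canonical-crossing⇒edge : ∀ {i j i′ j′} → CrossOn canonical k (i , j) (i′ , j′) → k ≡ i ⊔ i′
  canonical-crossing⇒edge {k} crossing = ≡⊔-of-starts (proj₁ tx) (proj₁ ty) (canonical-crossing⇒starts crossing)
    where
    tx = proj₂ (∈-leftEnd⁻ (proj₁ (CrossOn⇒∈ {λ′ = canonical} {k = k} crossing)))
    ty = proj₂ (∈-leftEnd⁻ (proj₂ (CrossOn⇒∈ {λ′ = canonical} {k = k} crossing)))

  canonical-crossingsAtLaterStart : CrossingsAtLaterStart L canonical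
  canonical-crossingsAtLaterStart _ _ _ _ _ _ i<i′ _ crossing =
    trans (canonical-crossing⇒edge crossing) (m≤n⇒m⊔n≡n (<⇒≤ i<i′))

module Comparison {n L μ} (inst : Instance n L) (feasible : Feasible n L μ) {σ} (realises : Realises L μ σ) where

  open Canonical inst σ

  private
    wf = proj₁ feasible
    adm = proj₁ (proj₂ feasible)

  startClass<⇒Above : ∀ {i j i′ j′} → (i , j) ∈ L → (i′ , j′) ∈ L →
    Traverses k (i , j) → Traverses k (i′ , j′) →
    startClass k (i , j) < startClass k (i′ , j′) → Above (leftEnd μ k) (i , j) (i′ , j′)
  startClass<⇒Above {k} {i} {j} {i′} {j′} x∈L y∈L tx ty lt with i ≟ k | i′ ≟ k
  ... | no _ | no _ = contradiction lt (<-irrefl refl)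
  startClass<⇒Above {k} {i} {j} {i′} {j′} x∈L y∈L tx ty lt | yes refl | yes refl
    with startsOnTop (i , j) | proj₁ (realises x∈L) | startsOnTop (i , j′) | proj₁ (realises y∈L) | lt
  ... | true | x-top | false | y-bottom , t , t∈L , t-passes | _ =
    let 1≤k , k<n = traverses⇒edge inst x∈L tx in
    Above-trans (Unique-leftEnd inst wf 1≤k k<n) (x-top t∈L t-passes) (y-bottom t∈L t-passes)
  ... | true | _ | true | _ | ()
  ... | false | _ | true | _ | ()
  ... | false | _ | false | _ | s≤s (s≤s ())
  startClass<⇒Above {k} {i} {j} {i′} {j′} x∈L y∈L tx (i′≤k , k<j′) lt | yes refl | no i′≢k
    with startsOnTop (i , j) | proj₁ (realises x∈L) | lt
  ... | true | x-top | _ = x-top y∈L (≤∧≢⇒< i′≤k i′≢k , k<j′)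
  ... | false | _ | s≤s ()
  startClass<⇒Above {k} {i} {j} {i′} {j′} x∈L y∈L (i≤k , k<j) ty lt | no i≢k | yes refl
    with startsOnTop (i′ , j′) | proj₁ (realises y∈L) | lt
  ... | false | y-bottom , _ | _ = y-bottom x∈L (≤∧≢⇒< i≤k i≢k , k<j)
  ... | true | _ | ()

  endKey<⇒Above : ∀ {i j i′ j′} → (i , j) ∈ L → (i′ , j′) ∈ L →
    Traverses k (i , j) → Traverses k (i′ , j′) →
    endKey (i , j) < endKey (i′ , j′) →
    ∃[ e ] k < e × e ≤ j × e ≤ j′ × Above (rightEnd μ (e ∸ 1)) (i , j) (i′ , j′)
  endKey<⇒Above {k} {i} {j} {i′} {j′} x∈L y∈L tx ty lt with <-cmp j j′
  endKey<⇒Above {k} {i} {j} {i′} {j′} x∈L y∈L (_ , k<j) (i′≤k , _) lt | tri< j<j′ _ _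
    with endsOnTop (i , j) | proj₂ (realises x∈L) | lt
  ... | true | x-top | _ = j , k<j , ≤-refl , <⇒≤ j<j′ , x-top y∈L (≤-<-trans i′≤k k<j , j<j′)
  ... | false | _ | lt′ = contradiction lt′ (<-asym (endKey<1+n+n∸ j<j′ (proj₂ (proj₂ (valid y∈L)))))
  endKey<⇒Above {k} {i} {j} {i′} {j′} x∈L y∈L (i≤k , _) (_ , k<j′) lt | tri> _ _ j′<j
    with endsOnTop (i′ , j′) | proj₂ (realises y∈L) | lt
  ... | false | y-bottom , _ | _ = j′ , k<j′ , <⇒≤ j′<j , ≤-refl , y-bottom x∈L (≤-<-trans i≤k k<j′ , j′<j)
  ... | true | _ | lt′ = contradiction lt′ (<-asym (<endKey j′<j (proj₂ (proj₂ (valid x∈L)))))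
  endKey<⇒Above {k} {i} {j} {i′} {j′} x∈L y∈L (_ , k<j) _ lt | tri≈ _ refl _
    with endsOnTop (i , j) | proj₂ (realises x∈L) | endsOnTop (i′ , j) | proj₂ (realises y∈L) | lt
  ... | true | x-top | false | y-bottom , t , t∈L , t-passes | _ =
    let _ , i<j , j≤n = valid x∈L
        1≤j∸1 , j∸1<n = traverses⇒edge inst x∈L (traverses-last i<j) in
    j , k<j , ≤-refl , ≤-refl ,
    Above-trans (Unique-rightEnd inst wf 1≤j∸1 j∸1<n) (x-top t∈L t-passes) (y-bottom t∈L t-passes)
  ... | true | _ | true | _ | lt′ = contradiction lt′ (<-irrefl refl)
  ... | false | _ | false | _ | lt′ = contradiction lt′ (<-irrefl refl)
  ... | false | _ | true | _ | lt′ =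
    let j≤n = proj₂ (proj₂ (valid x∈L)) in contradiction lt′ (<-asym (≤-<-trans j≤n (n<1+n+n∸j j≤n)))

  reversedKeys⇒crossing : ∀ {i j i′ j′} → (i , j) ∈ L → (i′ , j′) ∈ L →
    Traverses k (i , j) → Traverses k (i′ , j′) →
    leftKey k (i , j) <ˡ leftKey k (i′ , j′) → rightKey (i′ , j′) <ʳ rightKey (i , j) →
    ∃[ k′ ] 1 ≤ k′ × k′ < n × CrossOn μ k′ (i , j) (i′ , j′)
  reversedKeys⇒crossing {k} x∈L y∈L tx@(i≤k , _) ty@(i′≤k , _) left< right> =
    let 1≤k , k<n = traverses⇒edge inst x∈L tx
        class< = reversedKeys⇒startClass< left< right>
        endKey> = reversedKeys⇒endKey< i≤k i′≤k 1≤k (<⇒≤ k<n) left< right>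
        e , k<e , e≤j′ , e≤j , right-y≻x = endKey<⇒Above y∈L x∈L ty tx endKey>
        k≤e∸1 , e∸1<e = traverses-last k<e
        k′ , k≤k′ , k′≤e∸1 , crossing =
          order-change⇒crossing inst wf adm x∈L y∈L (λ { refl → <-irrefl refl class< }) i≤k i′≤k k≤e∸1
            (<-≤-trans e∸1<e e≤j) (<-≤-trans e∸1<e e≤j′) (startClass<⇒Above x∈L y∈L tx ty class<) right-y≻x
        1≤k′ , k′<n = traverses⇒edge inst x∈L
                        (≤-trans i≤k k≤k′ , ≤-<-trans k′≤e∸1 (<-≤-trans e∸1<e e≤j))
    in k′ , 1≤k′ , k′<n , crossing

  canonical-crossing⇒crossing : x ∈ L → y ∈ L → CrossOn canonical k x y →
                                ∃[ k′ ] 1 ≤ k′ × k′ < n × CrossOn μ k′ x y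
  canonical-crossing⇒crossing {i , j} {i′ , j′} {k} x∈L y∈L crossing
    with canonical-crossing⇒reversedKeys crossing
       | proj₂ (∈-leftEnd⁻ (proj₁ (CrossOn⇒∈ {λ′ = canonical} {k = k} crossing)))
       | proj₂ (∈-leftEnd⁻ (proj₂ (CrossOn⇒∈ {λ′ = canonical} {k = k} crossing)))
  ... | inj₁ (left< , right>) | tx | ty = reversedKeys⇒crossing x∈L y∈L tx ty left< right>
  ... | inj₂ (left> , right<) | tx | ty =
    let k′ , 1≤k′ , k′<n , crossing′ = reversedKeys⇒crossing y∈L x∈L ty tx left> right<
    in k′ , 1≤k′ , k′<n , CrossOn-sym {λ′ = μ} {k = k′} crossing′

  crossingsOfPair-canonical≤1 : ∀ {i j i′ j′} → crossingsOfPair n canonical ((i , j) , (i′ , j′)) ≤ 1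
  crossingsOfPair-canonical≤1 {i} {j} {i′} {j′} = sum-map-≤1 (upTo⁺ (n ∸ 1))
    (λ b → indicator≤1 (CrossOn? canonical (suc b) (i , j) (i′ , j′)))
    (λ {a} {b} a-crossing b-crossing → suc-injective (trans
      (canonical-crossing⇒edge (indicator-positive (CrossOn? canonical (suc a) (i , j) (i′ , j′)) a-crossing))
      (sym (canonical-crossing⇒edge (indicator-positive (CrossOn? canonical (suc b) (i , j) (i′ , j′)) b-crossing)))))

  crossingsOfPair-canonical≤ : x ∈ L → y ∈ L → crossingsOfPair n canonical (x , y) ≤ crossingsOfPair n μ (x , y)
  crossingsOfPair-canonical≤ {x} {y} x∈L y∈L =
    ≤-by-positivity crossingsOfPair-canonical≤1 λ crosses-canonically →
    let b , _ , b-crossing = sum-map-positive (λ b → crosses canonical (suc b) (x , y)) (upTo (n ∸ 1))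
                                              crosses-canonically
        k′ , 1≤k′ , k′<n , crossing = canonical-crossing⇒crossing x∈L y∈L
                                        (indicator-positive (CrossOn? canonical (suc b) x y) b-crossing)
    in crosses-at k′ 1≤k′ k′<n crossing
    where
    crosses-at : ∀ k′ → 1 ≤ k′ → k′ < n → CrossOn μ k′ x y → 1 ≤ crossingsOfPair n μ (x , y)
    crosses-at (suc b) _ 1+b<n crossing = ≤-trans (≤-reflexive (sym (indicator-yes (CrossOn? μ (suc b) x y) crossing)))
      (≤-sum-map (λ b → crosses μ (suc b) (x , y)) (∈-upTo⁺ (suc<⇒<∸1 n 1+b<n)))

  canonical-crossingNumber≤ : crossingNumber n canonical ≤ crossingNumber n μ
  canonical-crossingNumber≤ = begin
    crossingNumber n canonical
      ≡⟨ crossingNumber≡sumPairs (proj₂ inst) canonical-wellFormed ⟩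
    sum (map (crossingsOfPair n canonical) (orderedPairs L))
      ≤⟨ sum-map-mono (orderedPairs L) pair≤ ⟩
    sum (map (crossingsOfPair n μ) (orderedPairs L))
      ≡⟨ crossingNumber≡sumPairs (proj₂ inst) wf ⟨
    crossingNumber n μ
      ∎
    where
    open ≤-Reasoning
    pair≤ : ∀ {p} → p ∈ orderedPairs L → crossingsOfPair n canonical p ≤ crossingsOfPair n μ p
    pair≤ {x , y} p∈ = let x∈L , y∈L = Above⇒∈ (orderedPairs⇒Above p∈) in
                       crossingsOfPair-canonical≤ x∈L y∈L

corollary2 : (n : ℕ) (L : List Line) → Instance n L →
    Σ Layout (λ λ′ → Optimal n L λ′ × CrossingsAtLaterStart L λ′)
corollary2 n L inst = canonical , (canonical-feasible , optimal) , canonical-crossingsAtLaterStart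
  where
  cost : Sides → ℕ
  cost σ = crossingNumber n (Canonical.canonical inst σ)

  best : Sides
  best = argmin cost (λ _ → true , true) (allSides L)

  open Canonical inst best

  optimal : ∀ μ → Feasible n L μ → crossingNumber n canonical ≤ crossingNumber n μ
  optimal μ feasible =
    let σ , σ∈ , σ≗sidesOfμ = allSides-complete (sidesOf L μ) L
        realises = Realises-cong {μ = μ} σ≗sidesOfμ (sidesOf-realises {μ = μ} (proj₂ (proj₂ feasible)))
    in ≤-trans (All.lookup (f[argmin]≤f[xs] {f = cost} (λ _ → true , true) (allSides L)) σ∈)
               (Comparison.canonical-crossingNumber≤ inst feasible realises)
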